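{- There are no planes in $\mathrm{PG}(5,q)$ with rank distribution $[2,n_2,n_3]$ where $n_2<q$.
   Context: $q$ is odd. Points of $\mathrm{PG}(5,q)$ are represented by symmetric $3\times3$ matrices over $\mathbb{F}_q$ (up to scalars), and the rank of a point is the rank of its matrix; the rank-1 points form the quadric Veronesean $\mathcal{V}(\mathbb{F}_q)$. The rank distribution of a subspace $W$ is $[m_1,m_2,m_3]$ where $m_i$ is the number of rank-$i$ points in $W$. -}

module Defs where

open import Level using (Level; suc; _⊔_)
open import Data.Nat using (ℕ) renaming (zero to zeroℕ; suc to sucℕ)
open import Data.Product using (_×_; _,_; ∃)
open import Data.Sum using (_⊎_)
open import Data.List using (List; length; filter; concatMap; map)
open import Data.List.Membership.Propositional using (_∈_)
open import Data.List.Relation.Unary.Unique.Propositional using (Unique)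
open import Relation.Nullary using (¬_; Dec; yes; no)
open import Relation.Nullary.Decidable using (_×-dec_; _⊎-dec_)
open import Relation.Unary using (Decidable)
open import Relation.Binary.PropositionalEquality using (_≡_; _≢_)
open import Data.Unit.Polymorphic using (⊤)
open import Algebra.Structures using (IsCommutativeRing)

record FiniteField (ℓ : Level) : Set (suc ℓ) where
  infixl 7 _*_
  infixl 6 _+_ _-_
  field
    Carrier : Set ℓ
    _+_ _*_ : Carrier → Carrier → Carrier
    -_      : Carrier → Carrier
    0# 1#   : Carrier
    isCommutativeRing : IsCommutativeRing _≡_ _+_ _*_ -_ 0# 1#
    0≢1     : 0# ≢ 1#
    inverse : ∀ x → x ≢ 0# → ∃ λ y → x * y ≡ 1#
    _≟_     : (x y : Carrier) → Dec (x ≡ y)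
    elements : List Carrier
    elements-unique   : Unique elements
    elements-complete : ∀ x → x ∈ elements

  _-_ : Carrier → Carrier → Carrier
  x - y = x + (- y)

  order : ℕ
  order = length elements

module PG5 {ℓ} (F : FiniteField ℓ) where
  open FiniteField F

  -- A vector of F^6, read as the symmetric matrix
  --   [ a b c ]
  --   [ b d e ]
  --   [ c e f ]
  record Vec6 : Set ℓ where
    constructor v6
    field a b c d e f : Carrier
  open Vec6

  zeroV : Vec6
  zeroV = v6 0# 0# 0# 0# 0# 0#

  _+V_ : Vec6 → Vec6 → Vec6
  v6 a b c d e f +V v6 a' b' c' d' e' f' =
    v6 (a + a') (b + b') (c + c') (d + d') (e + e') (f + f')

  _·_ : Carrier → Vec6 → Vec6
  λ' · v6 a b c d e f = v6 (λ' * a) (λ' * b) (λ' * c) (λ' * d) (λ' * e) (λ' * f)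

  IsZeroMat : Vec6 → Set ℓ
  IsZeroMat (v6 a b c d e f) =
    a ≡ 0# × b ≡ 0# × c ≡ 0# × d ≡ 0# × e ≡ 0# × f ≡ 0#

  minors : Vec6 → List Carrier
  minors (v6 a b c d e f) =
    (a * d - b * b) Data.List.∷ (a * e - c * b) Data.List.∷ (b * e - c * d) Data.List.∷
    (a * e - b * c) Data.List.∷ (a * f - c * c) Data.List.∷ (b * f - c * e) Data.List.∷
    (b * e - d * c) Data.List.∷ (b * f - e * c) Data.List.∷ (d * f - e * e) Data.List.∷ Data.List.[]

  det : Vec6 → Carrier
  det (v6 a b c d e f) =
    a * (d * f - e * e) - b * (b * f - e * c) + c * (b * e - d * c)

  allZero : List Carrier → Set ℓ
  allZero Data.List.[] = ⊤
  allZero (x Data.List.∷ xs) = x ≡ 0# × allZero xs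

  allZero? : (xs : List Carrier) → Dec (allZero xs)
  allZero? Data.List.[] = yes _
  allZero? (x Data.List.∷ xs) = (x ≟ 0#) ×-dec allZero? xs

  isZeroMat? : (v : Vec6) → Dec (IsZeroMat v)
  isZeroMat? (v6 a b c d e f) =
    (a ≟ 0#) ×-dec (b ≟ 0#) ×-dec (c ≟ 0#) ×-dec (d ≟ 0#) ×-dec (e ≟ 0#) ×-dec (f ≟ 0#)

  rank : Vec6 → ℕ
  rank v with isZeroMat? v
  ... | yes _ = 0
  ... | no _ with allZero? (minors v)
  ...   | yes _ = 1
  ...   | no _ with det v ≟ 0#
  ...     | yes _ = 2
  ...     | no _  = 3

  comb : Vec6 → Vec6 → Vec6 → Carrier → Carrier → Carrier → Vec6
  comb u₁ u₂ u₃ x y z = ((x · u₁) +V (y · u₂)) +V (z · u₃)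

  LinearlyIndependent : Vec6 → Vec6 → Vec6 → Set ℓ
  LinearlyIndependent u₁ u₂ u₃ =
    ∀ x y z → comb u₁ u₂ u₃ x y z ≡ zeroV → x ≡ 0# × y ≡ 0# × z ≡ 0#

  -- Projective points of the plane ⟨u₁,u₂,u₃⟩ correspond bijectively
  -- (for independent u's) to normalised coordinate triples (x,y,z):
  -- first non-zero coordinate equal to 1.
  Normalised : Carrier → Carrier → Carrier → Set ℓ
  Normalised x y z =
    x ≡ 1# ⊎ (x ≡ 0# × y ≡ 1#) ⊎ (x ≡ 0# × y ≡ 0# × z ≡ 1#)

  normalised? : ∀ x y z → Dec (Normalised x y z)
  normalised? x y z =
    (x ≟ 1#) ⊎-dec ((x ≟ 0#) ×-dec (y ≟ 1#)) ⊎-dec ((x ≟ 0#) ×-dec (y ≟ 0#) ×-dec (z ≟ 1#))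

  triples : List (Carrier × Carrier × Carrier)
  triples = concatMap (λ x → concatMap (λ y → map (λ z → x , y , z) elements) elements) elements

  normTriples : List (Carrier × Carrier × Carrier)
  normTriples = filter (λ { (x , y , z) → normalised? x y z }) triples

  rankCount : Vec6 → Vec6 → Vec6 → ℕ → ℕ
  rankCount u₁ u₂ u₃ i =
    length (filter (λ { (x , y , z) → Data.Nat._≟_ (rank (comb u₁ u₂ u₃ x y z)) i })
                   normTriples)

-- Let t₁ and t₂ be the two rank-1 points of the plane; their matrices are multiples of a aᵀ and
-- b bᵀ. Choosing a third point e off the line t₁t₂, with matrix M, the points of the plane get
-- matrices x a aᵀ + y b bᵀ + z M. On the line z = 0 the determinant vanishes, and the q − 1 points
-- a aᵀ + s b bᵀ with s ≠ 0 have rank 2. Because a aᵀ and b bᵀ have rank one, at z = 1 the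
-- determinant is the bilinear polynomial det M + x aᵀ(adj M)a + y bᵀ(adj M)b + xy (a×b)ᵀM(a×b),
-- which has a root unless its three non-constant coefficients vanish. In that case M is singular:
-- Jacobi's identity makes the form of adj M vanish on span(a, b), and the Gram determinant of adj M
-- on a, b and a vector c with (a×b)·c ≠ 0 gives ((a×b)·c)² (det M)² = 0. The root is a q-th
-- rank-2 point.
{-# OPTIONS --safe #-}
module Submission where

open import Defs
open import Level using (Level)
open import Data.Nat using (ℕ; _<_; _%_)
open import Data.Product using (_×_)
open import Relation.Nullary using (¬_)
open import Relation.Binary.PropositionalEquality using (_≡_; _≢_)

open import Algebra.Bundles using (CommutativeRing; RawRing)
open import Data.Nat.Base as ℕ using (zero; suc; _≤_; z≤n; s≤s)
import Data.Nat.Properties as ℕ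
open import Data.Integer.Base as ℤ using (ℤ; +_; -[1+_]; _⊖_; sign; ∣_∣; _◃_)
import Data.Integer.Properties as ℤ
open import Data.Sign.Base as Sign using (Sign)
open import Data.Maybe.Base using (Maybe; just; nothing)
open import Data.Product using (_,_; proj₁; proj₂; ∃; ∃₂)
open import Data.Sum using (_⊎_; inj₁; inj₂)
open import Data.Empty using (⊥-elim)
open import Function.Base using (_∘_)
open import Data.List.Base
  using (List; []; _∷_; _++_; length; filter; map; concatMap; cartesianProductWith; cartesianProduct)
open import Data.List.Membership.Propositional using (_∈_)
open import Data.List.Membership.Propositional.Properties
  using (∈-filter⁺; ∈-filter⁻; ∈-map⁻; ∈-cartesianProduct⁺)
open import Data.List.Relation.Unary.Any as Any using (here; there)
open import Data.List.Relation.Unary.All as All using ()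
open import Data.List.Relation.Unary.AllPairs using (_∷_)
open import Data.List.Relation.Unary.Unique.Propositional using (Unique)
import Data.List.Relation.Unary.Unique.Propositional.Properties as Unique
import Data.List.Properties as List
open import Data.List.Relation.Binary.Subset.Propositional using (_⊆_)
open import Relation.Nullary using (yes; no)
open import Relation.Unary using (Pred; Decidable)
import Relation.Binary.PropositionalEquality as ≡

module IntegerCoefficientRingSolver {c ℓ} (R : CommutativeRing c ℓ) where

  open CommutativeRing R
  open import Algebra.Properties.Ring ring
    using (-‿involutive; -0#≈0#; -‿distribˡ-*; -‿distribʳ-*; -‿anti-homo-+)
  -- The optimised multiple satisfies 1 ×ᴿ x = x definitionally, so the constants con (+ 0) and
  -- con (+ 1) evaluate to 0# and 1# on the nose and solver goals can be stated with them.
  open import Algebra.Properties.Semiring.Mult.TCOptimised semiring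
    using (×-homo-+; ×1-homo-*) renaming (_×_ to _×ᴿ_)
  open import Algebra.Solver.Ring.AlmostCommutativeRing
    using (fromCommutativeRing; _-Raw-AlmostCommutative⟶_)
  open import Relation.Binary.Reasoning.Setoid setoid

  signed : Sign → Carrier → Carrier
  signed Sign.+ x = x
  signed Sign.- x = - x

  signed-cong : ∀ s {x y} → x ≈ y → signed s x ≈ signed s y
  signed-cong Sign.+ x≈y = x≈y
  signed-cong Sign.- x≈y = -‿cong x≈y

  signed-* : ∀ s t x y → signed (s Sign.* t) (x * y) ≈ signed s x * signed t y
  signed-* Sign.+ Sign.+ x y = refl
  signed-* Sign.+ Sign.- x y = -‿distribʳ-* x y
  signed-* Sign.- Sign.+ x y = -‿distribˡ-* x y
  signed-* Sign.- Sign.- x y = begin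
    x * y        ≈⟨ -‿involutive (x * y) ⟨
    - - (x * y)  ≈⟨ -‿cong (-‿distribˡ-* x y) ⟩
    - (- x * y)  ≈⟨ -‿distribʳ-* (- x) y ⟩
    - x * - y    ∎

  ⟦_⟧ : ℤ → Carrier
  ⟦ i ⟧ = signed (sign i) (∣ i ∣ ×ᴿ 1#)

  ◃-homo : ∀ s n → ⟦ s ◃ n ⟧ ≈ signed s (n ×ᴿ 1#)
  ◃-homo Sign.+ zero    = refl
  ◃-homo Sign.- zero    = sym -0#≈0#
  ◃-homo Sign.+ (suc n) = refl
  ◃-homo Sign.- (suc n) = refl

  *-homo : ∀ i j → ⟦ i ℤ.* j ⟧ ≈ ⟦ i ⟧ * ⟦ j ⟧
  *-homo i j = begin
    ⟦ s ◃ ∣ i ∣ ℕ.* ∣ j ∣ ⟧                     ≈⟨ ◃-homo s (∣ i ∣ ℕ.* ∣ j ∣) ⟩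
    signed s ((∣ i ∣ ℕ.* ∣ j ∣) ×ᴿ 1#)          ≈⟨ signed-cong s (×1-homo-* ∣ i ∣ ∣ j ∣) ⟩
    signed s ((∣ i ∣ ×ᴿ 1#) * (∣ j ∣ ×ᴿ 1#))    ≈⟨ signed-* (sign i) (sign j) _ _ ⟩
    ⟦ i ⟧ * ⟦ j ⟧                               ∎
    where
    s : Sign
    s = sign i Sign.* sign j

  suc-× : ∀ n → suc n ×ᴿ 1# ≈ 1# + n ×ᴿ 1#
  suc-× n = ×-homo-+ 1# 1 n

  1+x-[1+y]≈x-y : ∀ x y → (1# + x) - (1# + y) ≈ x - y
  1+x-[1+y]≈x-y x y = begin
    (1# + x) - (1# + y)      ≈⟨ +-cong (+-comm 1# x) (-‿anti-homo-+ 1# y) ⟩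
    (x + 1#) + (- y - 1#)    ≈⟨ +-assoc x 1# _ ⟩
    x + (1# + (- y - 1#))    ≈⟨ +-congˡ (+-comm 1# _) ⟩
    x + ((- y - 1#) + 1#)    ≈⟨ +-congˡ (+-assoc (- y) (- 1#) 1#) ⟩
    x + (- y + (- 1# + 1#))  ≈⟨ +-congˡ (+-congˡ (-‿inverseˡ 1#)) ⟩
    x + (- y + 0#)           ≈⟨ +-congˡ (+-identityʳ (- y)) ⟩
    x - y                    ∎

  ⊖-homo : ∀ m n → ⟦ m ⊖ n ⟧ ≈ m ×ᴿ 1# - n ×ᴿ 1#
  ⊖-homo zero    zero    = sym (-‿inverseʳ 0#)
  ⊖-homo (suc m) zero    = sym (trans (+-congˡ -0#≈0#) (+-identityʳ _))
  ⊖-homo zero    (suc n) = sym (+-identityˡ _)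
  ⊖-homo (suc m) (suc n) = begin
    ⟦ suc m ⊖ suc n ⟧                  ≡⟨ ≡.cong ⟦_⟧ (ℤ.[1+m]⊖[1+n]≡m⊖n m n) ⟩
    ⟦ m ⊖ n ⟧                          ≈⟨ ⊖-homo m n ⟩
    m ×ᴿ 1# - n ×ᴿ 1#                  ≈⟨ 1+x-[1+y]≈x-y (m ×ᴿ 1#) (n ×ᴿ 1#) ⟨
    (1# + m ×ᴿ 1#) - (1# + n ×ᴿ 1#)    ≈⟨ +-cong (suc-× m) (-‿cong (suc-× n)) ⟨
    suc m ×ᴿ 1# - suc n ×ᴿ 1#          ∎

  +-homo : ∀ i j → ⟦ i ℤ.+ j ⟧ ≈ ⟦ i ⟧ + ⟦ j ⟧
  +-homo (+ m)    (+ n)    = ×-homo-+ 1# m n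
  +-homo (+ m)    -[1+ n ] = ⊖-homo m (suc n)
  +-homo -[1+ m ] (+ n)    = trans (⊖-homo n (suc m)) (+-comm _ _)
  +-homo -[1+ m ] -[1+ n ] = begin
    - (suc (suc (m ℕ.+ n)) ×ᴿ 1#)        ≡⟨ ≡.cong (λ k → - (suc k ×ᴿ 1#)) (ℕ.+-suc m n) ⟨
    - ((suc m ℕ.+ suc n) ×ᴿ 1#)          ≈⟨ -‿cong (×-homo-+ 1# (suc m) (suc n)) ⟩
    - (suc m ×ᴿ 1# + suc n ×ᴿ 1#)        ≈⟨ -‿anti-homo-+ _ _ ⟩
    - (suc n ×ᴿ 1#) + - (suc m ×ᴿ 1#)    ≈⟨ +-comm _ _ ⟩
    - (suc m ×ᴿ 1#) + - (suc n ×ᴿ 1#)    ∎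

  -‿homo : ∀ i → ⟦ ℤ.- i ⟧ ≈ - ⟦ i ⟧
  -‿homo -[1+ n ]  = sym (-‿involutive _)
  -‿homo (+ zero)  = sym -0#≈0#
  -‿homo (+ suc n) = refl

  morphism : ℤ.+-*-rawRing -Raw-AlmostCommutative⟶ fromCommutativeRing R
  morphism = record
    { ⟦_⟧ = ⟦_⟧ ; +-homo = +-homo ; *-homo = *-homo ; -‿homo = -‿homo
    ; 0-homo = refl ; 1-homo = refl
    }

  _≟⟦⟧_ : ∀ i j → Maybe (⟦ i ⟧ ≈ ⟦ j ⟧)
  i ≟⟦⟧ j with i ℤ.≟ j
  ... | yes ≡.refl = just refl
  ... | no  _      = nothing

  open import Algebra.Solver.Ring ℤ.+-*-rawRing (fromCommutativeRing R) morphism _≟⟦⟧_ public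
    using (Polynomial; solve; _:=_; _:+_; _:*_; _:-_; :-_; con)

-- The vector and symmetric-matrix formulas are written once over an arbitrary raw ring: at the
-- field they define adj, outer, form, …; at the solver's polynomial syntax they produce the two
-- sides of each identity passed to solve. detₘ, _·ₘ_ and _+ₘ_ copy det, _·_ and _+V_ from Defs
-- and are only used on the syntax side.
record Sym3 {a} (A : Set a) : Set a where
  constructor sym3
  field s₁₁ s₁₂ s₁₃ s₂₂ s₂₃ s₃₃ : A

module SymmetricMatrixFormulas
  {a ℓ m} (R : RawRing a ℓ) {Mat : Set m}
  (mat : (x₁₁ x₁₂ x₁₃ x₂₂ x₂₃ x₃₃ : RawRing.Carrier R) → Mat)
  (m₁₁ m₁₂ m₁₃ m₂₂ m₂₃ m₃₃ : Mat → RawRing.Carrier R) where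

  open RawRing R

  infixl 6 _-_ _⊕_ _+ₘ_
  infixl 7 _⊙_ _∙_ _·ₘ_
  infixl 8 _⨯_

  _-_ : Carrier → Carrier → Carrier
  x - y = x + (- y)

  Carrier³ : Set a
  Carrier³ = Carrier × Carrier × Carrier

  _⊕_ : Carrier³ → Carrier³ → Carrier³
  (x , y , z) ⊕ (x′ , y′ , z′) = x + x′ , y + y′ , z + z′

  _⊙_ : Carrier → Carrier³ → Carrier³
  k ⊙ (x , y , z) = k * x , k * y , k * z

  _∙_ : Carrier³ → Carrier³ → Carrier
  (x , y , z) ∙ (x′ , y′ , z′) = x * x′ + y * y′ + z * z′

  _⨯_ : Carrier³ → Carrier³ → Carrier³
  (x , y , z) ⨯ (x′ , y′ , z′) = y * z′ - z * y′ , z * x′ - x * z′ , x * y′ - y * x′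

  _*ᵥ_ : Mat → Carrier³ → Carrier³
  M *ᵥ (x , y , z) =
    m₁₁ M * x + m₁₂ M * y + m₁₃ M * z ,
    m₁₂ M * x + m₂₂ M * y + m₂₃ M * z ,
    m₁₃ M * x + m₂₃ M * y + m₃₃ M * z

  form : Mat → Carrier³ → Carrier³ → Carrier
  form M u v = u ∙ (M *ᵥ v)

  outer : Carrier³ → Mat
  outer (x , y , z) = mat (x * x) (x * y) (x * z) (y * y) (y * z) (z * z)

  adj : Mat → Mat
  adj M = mat (d * f - e * e) (c * e - b * f) (b * e - c * d) (a′ * f - c * c) (b * c - a′ * e) (a′ * d - b * b)
    where a′ = m₁₁ M; b = m₁₂ M; c = m₁₃ M; d = m₂₂ M; e = m₂₃ M; f = m₃₃ M

  gram : Mat → Carrier³ → Carrier³ → Carrier³ → Mat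
  gram N u v w = mat (form N u u) (form N u v) (form N u w) (form N v v) (form N v w) (form N w w)

  detₘ : Mat → Carrier
  detₘ M = a′ * (d * f - e * e) - b * (b * f - e * c) + c * (b * e - d * c)
    where a′ = m₁₁ M; b = m₁₂ M; c = m₁₃ M; d = m₂₂ M; e = m₂₃ M; f = m₃₃ M

  _·ₘ_ : Carrier → Mat → Mat
  k ·ₘ M = mat (k * m₁₁ M) (k * m₁₂ M) (k * m₁₃ M) (k * m₂₂ M) (k * m₂₃ M) (k * m₃₃ M)

  _+ₘ_ : Mat → Mat → Mat
  M +ₘ N = mat (m₁₁ M + m₁₁ N) (m₁₂ M + m₁₂ N) (m₁₃ M + m₁₃ N) (m₂₂ M + m₂₂ N) (m₂₃ M + m₂₃ N) (m₃₃ M + m₃₃ N)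

concatMap-map≡cartesianProductWith : ∀ {a b c} {A : Set a} {B : Set b} {C : Set c}
  (f : A → B → C) xs ys → concatMap (λ x → map (f x) ys) xs ≡ cartesianProductWith f xs ys
concatMap-map≡cartesianProductWith f []       ys = ≡.refl
concatMap-map≡cartesianProductWith f (x ∷ xs) ys =
  ≡.cong (map (f x) ys ++_) (concatMap-map≡cartesianProductWith f xs ys)

module _ {a} {A : Set a} where

  ∈-─⁺ : ∀ {xs : List A} {x y} (x∈xs : x ∈ xs) → y ∈ xs → x ≢ y → y ∈ (xs Any.─ x∈xs)
  ∈-─⁺ (here ≡.refl) (here ≡.refl) x≢y = ⊥-elim (x≢y ≡.refl)
  ∈-─⁺ (here _)      (there y∈xs)  _   = y∈xs
  ∈-─⁺ (there _)     (here y≡z)    _   = here y≡z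
  ∈-─⁺ (there x∈xs)  (there y∈xs)  x≢y = there (∈-─⁺ x∈xs y∈xs x≢y)

  Unique-⊆⇒length≤ : ∀ {xs ys : List A} → Unique xs → xs ⊆ ys → length xs ≤ length ys
  Unique-⊆⇒length≤ {[]}     _                  _       = z≤n
  Unique-⊆⇒length≤ {x ∷ xs} {ys} (x∉xs ∷ unique) x∷xs⊆ys =
    ≡.subst (length (x ∷ xs) ≤_) (≡.sym (List.length-removeAt′ ys (Any.index x∈ys)))
      (s≤s (Unique-⊆⇒length≤ unique
        (λ y∈xs → ∈-─⁺ x∈ys (x∷xs⊆ys (there y∈xs)) (All.lookup x∉xs y∈xs))))
    where
    x∈ys : x ∈ ys
    x∈ys = x∷xs⊆ys (here ≡.refl)

  length≡2⇒pair : ∀ (xs : List A) → length xs ≡ 2 → ∃₂ λ x y → xs ≡ x ∷ y ∷ []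
  length≡2⇒pair (x ∷ y ∷ []) ≡.refl = x , y , ≡.refl

  module _ {p} {P : Pred A p} (P? : Decidable P) where

    Unique⇒length≤filter : ∀ {xs ys} → Unique ys → (∀ {y} → y ∈ ys → y ∈ xs × P y) →
                           length ys ≤ length (filter P? xs)
    Unique⇒length≤filter unique ys⊆ =
      Unique-⊆⇒length≤ unique (λ y∈ys → ∈-filter⁺ P? (proj₁ (ys⊆ y∈ys)) (proj₂ (ys⊆ y∈ys)))

    filter-length≡2 : ∀ {xs} → Unique xs → length (filter P? xs) ≡ 2 →
      ∃₂ λ x y → x ≢ y × (x ∈ xs × P x) × (y ∈ xs × P y) ×
                 (∀ {z} → z ∈ xs → P z → z ≡ x ⊎ z ≡ y)
    filter-length≡2 {xs} unique length≡2 with length≡2⇒pair (filter P? xs) length≡2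
    ... | x , y , filter≡ = x , y , x≢y , member (here ≡.refl) , member (there (here ≡.refl)) , among
      where
      x≢y : x ≢ y
      x≢y with (x≢y All.∷ All.[]) ∷ _ ← ≡.subst Unique filter≡ (Unique.filter⁺ P? unique) = x≢y

      member : ∀ {z} → z ∈ x ∷ y ∷ [] → z ∈ xs × P z
      member z∈ = ∈-filter⁻ P? (≡.subst (_ ∈_) (≡.sym filter≡) z∈)

      among : ∀ {z} → z ∈ xs → P z → z ≡ x ⊎ z ≡ y
      among z∈xs Pz with ≡.subst (_ ∈_) filter≡ (∈-filter⁺ P? z∈xs Pz)
      ... | here z≡x         = inj₁ z≡x
      ... | there (here z≡y) = inj₂ z≡y

module _ {ℓ} (F : FiniteField ℓ) where
  open FiniteField F
  open PG5 F
  open import Relation.Binary.PropositionalEquality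
    using (refl; sym; trans; cong; cong₂; subst; module ≡-Reasoning)
  open ≡-Reasoning

  commutativeRing : CommutativeRing ℓ ℓ
  commutativeRing = record { isCommutativeRing = isCommutativeRing }

  open CommutativeRing commutativeRing
    using (rawRing; ring; +-identityʳ; *-comm; *-assoc; *-identityˡ; *-identityʳ; zeroˡ; zeroʳ)
  open import Algebra.Properties.Ring ring using () renaming (x∙y⁻¹≈ε⇒x≈y to x-y≡0⇒x≡y)
  open IntegerCoefficientRingSolver commutativeRing
    using (Polynomial; solve; _:=_; _:+_; _:*_; _:-_; :-_; con)

  open SymmetricMatrixFormulas rawRing v6 Vec6.a Vec6.b Vec6.c Vec6.d Vec6.e Vec6.f
    hiding (_-_; detₘ; _·ₘ_; _+ₘ_)

  polynomialRing : ℕ → RawRing _ _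
  polynomialRing n = record
    { Carrier = Polynomial n ; _≈_ = _≡_ ; _+_ = _:+_ ; _*_ = _:*_ ; -_ = :-_
    ; 0# = con (+ 0) ; 1# = con (+ 1) }

  module P {n} = SymmetricMatrixFormulas (polynomialRing n) sym3
    Sym3.s₁₁ Sym3.s₁₂ Sym3.s₁₃ Sym3.s₂₂ Sym3.s₂₃ Sym3.s₃₃

  :0 :1 : ∀ {n} → Polynomial n
  :0 = con (+ 0)
  :1 = con (+ 1)

  -- Field arithmetic

  1≢0 : 1# ≢ 0#
  1≢0 1≡0 = 0≢1 (sym 1≡0)

  inv : (x : Carrier) → x ≢ 0# → Carrier
  inv x x≢0 = proj₁ (inverse x x≢0)

  *-inverseˡ : ∀ x (x≢0 : x ≢ 0#) → inv x x≢0 * x ≡ 1#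
  *-inverseˡ x x≢0 = trans (*-comm _ x) (proj₂ (inverse x x≢0))

  inv-cancelˡ : ∀ {x} (x≢0 : x ≢ 0#) y → inv x x≢0 * (x * y) ≡ y
  inv-cancelˡ {x} x≢0 y = begin
    inv x x≢0 * (x * y)  ≡⟨ *-assoc _ x y ⟨
    inv x x≢0 * x * y    ≡⟨ cong (_* y) (*-inverseˡ x x≢0) ⟩
    1# * y               ≡⟨ *-identityˡ y ⟩
    y                    ∎

  *-cancelˡ : ∀ {x y z} → x ≢ 0# → x * y ≡ x * z → y ≡ z
  *-cancelˡ {x} {y} {z} x≢0 xy≡xz = begin
    y                    ≡⟨ inv-cancelˡ x≢0 y ⟨
    inv x x≢0 * (x * y)  ≡⟨ cong (inv x x≢0 *_) xy≡xz ⟩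
    inv x x≢0 * (x * z)  ≡⟨ inv-cancelˡ x≢0 z ⟩
    z                    ∎

  *-cancelʳ : ∀ {x y z} → x ≢ 0# → y * x ≡ z * x → y ≡ z
  *-cancelʳ {x} {y} {z} x≢0 yx≡zx = *-cancelˡ x≢0 (trans (*-comm x y) (trans yx≡zx (*-comm z x)))

  x*y≡0⇒y≡0 : ∀ {x y} → x ≢ 0# → x * y ≡ 0# → y ≡ 0#
  x*y≡0⇒y≡0 {x} x≢0 xy≡0 = *-cancelˡ x≢0 (trans xy≡0 (sym (zeroʳ x)))

  *-≢0 : ∀ {x y} → x ≢ 0# → y ≢ 0# → x * y ≢ 0#
  *-≢0 x≢0 y≢0 xy≡0 = y≢0 (x*y≡0⇒y≡0 x≢0 xy≡0)

  x*x≡0⇒x≡0 : ∀ {x} → x * x ≡ 0# → x ≡ 0#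
  x*x≡0⇒x≡0 {x} xx≡0 with x ≟ 0#
  ... | yes x≡0 = x≡0
  ... | no  x≢0 = x*y≡0⇒y≡0 x≢0 xx≡0

  inv-≢0 : ∀ x (x≢0 : x ≢ 0#) → inv x x≢0 ≢ 0#
  inv-≢0 x x≢0 inv≡0 = 0≢1 (begin
    0#              ≡⟨ zeroˡ x ⟨
    0# * x          ≡⟨ cong (_* x) inv≡0 ⟨
    inv x x≢0 * x   ≡⟨ *-inverseˡ x x≢0 ⟩
    1#              ∎)

  linear-root : ∀ δ {u} → u ≢ 0# → ∃ λ x → δ + x * u ≡ 0#
  linear-root δ {u} u≢0 = - (δ * inv u u≢0) , (begin
    δ + - (δ * inv u u≢0) * u   ≡⟨ solve 3 (λ δ i u → δ :+ :- (δ :* i) :* u := δ :- δ :* (i :* u)) refl δ _ u ⟩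
    δ - δ * (inv u u≢0 * u)     ≡⟨ cong (λ v → δ - δ * v) (*-inverseˡ u u≢0) ⟩
    δ - δ * 1#                  ≡⟨ solve 1 (λ δ → δ :- δ :* :1 := :0) refl δ ⟩
    0#                          ∎)

  bilinear-root : ∀ α β γ δ → (α ≡ 0# → β ≡ 0# → γ ≡ 0# → δ ≡ 0#) →
                  ∃₂ λ x y → δ + x * α + y * β + x * y * γ ≡ 0#
  bilinear-root α β γ δ degenerate with α ≟ 0# | β ≟ 0# | γ ≟ 0#
  ... | no α≢0 | _ | _ with x , root ← linear-root δ α≢0 = x , 0# , (begin
    δ + x * α + 0# * β + x * 0# * γ  ≡⟨ solve 5 (λ δ x α β γ → δ :+ x :* α :+ :0 :* β :+ x :* :0 :* γ := δ :+ x :* α) refl δ x α β γ ⟩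
    δ + x * α                        ≡⟨ root ⟩
    0#                               ∎)
  ... | yes refl | no β≢0 | _ with y , root ← linear-root δ β≢0 = 0# , y , (begin
    δ + 0# * 0# + y * β + 0# * y * γ  ≡⟨ solve 4 (λ δ y β γ → δ :+ :0 :* :0 :+ y :* β :+ :0 :* y :* γ := δ :+ y :* β) refl δ y β γ ⟩
    δ + y * β                         ≡⟨ root ⟩
    0#                                ∎)
  ... | yes refl | yes refl | no γ≢0 with y , root ← linear-root δ γ≢0 = 1# , y , (begin
    δ + 1# * 0# + y * 0# + 1# * y * γ  ≡⟨ solve 3 (λ δ y γ → δ :+ :1 :* :0 :+ y :* :0 :+ :1 :* y :* γ := δ :+ y :* γ) refl δ y γ ⟩
    δ + y * γ                          ≡⟨ root ⟩
    0#                                 ∎)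
  ... | yes refl | yes refl | yes refl = 0# , 0# , (begin
    δ + 0# * 0# + 0# * 0# + 0# * 0# * 0#  ≡⟨ solve 1 (λ δ → δ :+ :0 :* :0 :+ :0 :* :0 :+ :0 :* :0 :* :0 := δ) refl δ ⟩
    δ                                     ≡⟨ degenerate refl refl refl ⟩
    0#                                    ∎)

  -- Vectors in F³

  0₃ e₁ e₂ e₃ : Carrier³
  0₃ = 0# , 0# , 0#
  e₁ = 1# , 0# , 0#
  e₂ = 0# , 1# , 0#
  e₃ = 0# , 0# , 1#

  triple-cong : ∀ {x y z x′ y′ z′ : Carrier} → x ≡ x′ → y ≡ y′ → z ≡ z′ →
                (x , y , z) ≡ (x′ , y′ , z′)
  triple-cong refl refl refl = refl

  ∙-e₁ : ∀ x y z → (x , y , z) ∙ e₁ ≡ x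
  ∙-e₁ = solve 3 (λ x y z → (x , y , z) P.∙ (:1 , :0 , :0) := x) refl

  ∙-e₂ : ∀ x y z → (x , y , z) ∙ e₂ ≡ y
  ∙-e₂ = solve 3 (λ x y z → (x , y , z) P.∙ (:0 , :1 , :0) := y) refl

  ∙-e₃ : ∀ x y z → (x , y , z) ∙ e₃ ≡ z
  ∙-e₃ = solve 3 (λ x y z → (x , y , z) P.∙ (:0 , :0 , :1) := z) refl

  ≢0₃⇒∃∙≢0 : ∀ t → t ≢ 0₃ → ∃ λ c → t ∙ c ≢ 0#
  ≢0₃⇒∃∙≢0 (x , y , z) t≢0 with x ≟ 0# | y ≟ 0# | z ≟ 0#
  ... | no x≢0 | _      | _      = e₁ , λ t∙e≡0 → x≢0 (trans (sym (∙-e₁ x y z)) t∙e≡0)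
  ... | yes _  | no y≢0 | _      = e₂ , λ t∙e≡0 → y≢0 (trans (sym (∙-e₂ x y z)) t∙e≡0)
  ... | yes _  | yes _  | no z≢0 = e₃ , λ t∙e≡0 → z≢0 (trans (sym (∙-e₃ x y z)) t∙e≡0)
  ... | yes refl | yes refl | yes refl = ⊥-elim (t≢0 refl)

  Normalised₃ : Carrier³ → Set ℓ
  Normalised₃ (x , y , z) = Normalised x y z

  normalised⇒≢0₃ : ∀ {t} → Normalised₃ t → t ≢ 0₃
  normalised⇒≢0₃ (inj₁ 0≡1)                refl = 0≢1 0≡1
  normalised⇒≢0₃ (inj₂ (inj₁ (_ , 0≡1)))     refl = 0≢1 0≡1
  normalised⇒≢0₃ (inj₂ (inj₂ (_ , _ , 0≡1))) refl = 0≢1 0≡1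

  normalised⇒pivot : ∀ {t} → Normalised₃ t → ∃ λ e → t ∙ e ≡ 1#
  normalised⇒pivot {x , y , z} (inj₁ x≡1)                = e₁ , trans (∙-e₁ x y z) x≡1
  normalised⇒pivot {x , y , z} (inj₂ (inj₁ (_ , y≡1)))     = e₂ , trans (∙-e₂ x y z) y≡1
  normalised⇒pivot {x , y , z} (inj₂ (inj₂ (_ , _ , z≡1))) = e₃ , trans (∙-e₃ x y z) z≡1

  normalise : ∀ t → t ≢ 0₃ → ∃ λ k → k ≢ 0# × Normalised₃ (k ⊙ t)
  normalise (x , y , z) t≢0 with x ≟ 0# | y ≟ 0# | z ≟ 0#
  ... | no x≢0 | _ | _ =
    inv x x≢0 , inv-≢0 x x≢0 , inj₁ (*-inverseˡ x x≢0)
  ... | yes refl | no y≢0 | _ =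
    inv y y≢0 , inv-≢0 y y≢0 , inj₂ (inj₁ (zeroʳ _ , *-inverseˡ y y≢0))
  ... | yes refl | yes refl | no z≢0 =
    inv z z≢0 , inv-≢0 z z≢0 , inj₂ (inj₂ (zeroʳ _ , zeroʳ _ , *-inverseˡ z z≢0))
  ... | yes refl | yes refl | yes refl = ⊥-elim (t≢0 refl)

  normalised-scale≡1 : ∀ {k t} → Normalised₃ t → Normalised₃ (k ⊙ t) → k ≡ 1#
  normalised-scale≡1 {k} = go
    where
    same-pivot : ∀ {v} → v ≡ 1# → k * v ≡ 1# → k ≡ 1#
    same-pivot refl kv≡1 = trans (sym (*-identityʳ k)) kv≡1

    later-pivot : ∀ {v w} → v ≡ 1# → k * v ≡ 0# → k * w ≢ 1#
    later-pivot {w = w} refl kv≡0 kw≡1 =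
      0≢1 (trans (sym (zeroˡ w)) (trans (cong (_* w) (sym (trans (sym (*-identityʳ k)) kv≡0))) kw≡1))

    earlier-pivot : ∀ {v} → v ≡ 0# → k * v ≢ 1#
    earlier-pivot refl kv≡1 = 0≢1 (trans (sym (zeroʳ k)) kv≡1)

    go : ∀ {x y z} → Normalised x y z → Normalised (k * x) (k * y) (k * z) → k ≡ 1#
    go (inj₁ x≡1) (inj₁ kx≡1) = same-pivot x≡1 kx≡1
    go (inj₁ x≡1) (inj₂ (inj₁ (kx≡0 , ky≡1))) = ⊥-elim (later-pivot x≡1 kx≡0 ky≡1)
    go (inj₁ x≡1) (inj₂ (inj₂ (kx≡0 , _ , kz≡1))) = ⊥-elim (later-pivot x≡1 kx≡0 kz≡1)
    go (inj₂ (inj₁ (x≡0 , _))) (inj₁ kx≡1) = ⊥-elim (earlier-pivot x≡0 kx≡1)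
    go (inj₂ (inj₁ (_ , y≡1))) (inj₂ (inj₁ (_ , ky≡1))) = same-pivot y≡1 ky≡1
    go (inj₂ (inj₁ (_ , y≡1))) (inj₂ (inj₂ (_ , ky≡0 , kz≡1))) = ⊥-elim (later-pivot y≡1 ky≡0 kz≡1)
    go (inj₂ (inj₂ (x≡0 , _))) (inj₁ kx≡1) = ⊥-elim (earlier-pivot x≡0 kx≡1)
    go (inj₂ (inj₂ (_ , y≡0 , _))) (inj₂ (inj₁ (_ , ky≡1))) = ⊥-elim (earlier-pivot y≡0 ky≡1)
    go (inj₂ (inj₂ (_ , _ , z≡1))) (inj₂ (inj₂ (_ , _ , kz≡1))) = same-pivot z≡1 kz≡1

  ⊙-identityˡ : ∀ t → 1# ⊙ t ≡ t
  ⊙-identityˡ (x , y , z) = triple-cong (*-identityˡ x) (*-identityˡ y) (*-identityˡ z)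

  bac-cab : ∀ a b c → (a ∙ c) ⊙ b ≡ (b ∙ c) ⊙ a ⊕ (a ⨯ b) ⨯ c
  bac-cab (a₁ , a₂ , a₃) (b₁ , b₂ , b₃) (c₁ , c₂ , c₃) = triple-cong
    (solve 9 (λ a₁ a₂ a₃ b₁ b₂ b₃ c₁ c₂ c₃ → let a = a₁ , a₂ , a₃; b = b₁ , b₂ , b₃; c = c₁ , c₂ , c₃ in
      proj₁ ((a P.∙ c) P.⊙ b) := proj₁ ((b P.∙ c) P.⊙ a P.⊕ (a P.⨯ b) P.⨯ c))
      refl a₁ a₂ a₃ b₁ b₂ b₃ c₁ c₂ c₃)
    (solve 9 (λ a₁ a₂ a₃ b₁ b₂ b₃ c₁ c₂ c₃ → let a = a₁ , a₂ , a₃; b = b₁ , b₂ , b₃; c = c₁ , c₂ , c₃ in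
      proj₁ (proj₂ ((a P.∙ c) P.⊙ b)) := proj₁ (proj₂ ((b P.∙ c) P.⊙ a P.⊕ (a P.⨯ b) P.⨯ c)))
      refl a₁ a₂ a₃ b₁ b₂ b₃ c₁ c₂ c₃)
    (solve 9 (λ a₁ a₂ a₃ b₁ b₂ b₃ c₁ c₂ c₃ → let a = a₁ , a₂ , a₃; b = b₁ , b₂ , b₃; c = c₁ , c₂ , c₃ in
      proj₂ (proj₂ ((a P.∙ c) P.⊙ b)) := proj₂ (proj₂ ((b P.∙ c) P.⊙ a P.⊕ (a P.⨯ b) P.⨯ c)))
      refl a₁ a₂ a₃ b₁ b₂ b₃ c₁ c₂ c₃)

  ⨯-zeroˡ : ∀ c → 0₃ ⨯ c ≡ 0₃
  ⨯-zeroˡ (c₁ , c₂ , c₃) = triple-cong (vanishes c₃ c₂) (vanishes c₁ c₃) (vanishes c₂ c₁)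
    where
    vanishes : ∀ c c′ → 0# * c - 0# * c′ ≡ 0#
    vanishes = solve 2 (λ c c′ → :0 :* c :- :0 :* c′ := :0) refl

  ⊕-identityʳ : ∀ t → t ⊕ 0₃ ≡ t
  ⊕-identityʳ (x , y , z) = triple-cong (+-identityʳ x) (+-identityʳ y) (+-identityʳ z)

  ⨯≡0₃⇒proportional : ∀ {a b} c → a ⨯ b ≡ 0₃ → (a ∙ c) ⊙ b ≡ (b ∙ c) ⊙ a
  ⨯≡0₃⇒proportional {a} {b} c a⨯b≡0 = begin
    (a ∙ c) ⊙ b                ≡⟨ bac-cab a b c ⟩
    (b ∙ c) ⊙ a ⊕ (a ⨯ b) ⨯ c  ≡⟨ cong (λ w → (b ∙ c) ⊙ a ⊕ w ⨯ c) a⨯b≡0 ⟩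
    (b ∙ c) ⊙ a ⊕ 0₃ ⨯ c       ≡⟨ cong ((b ∙ c) ⊙ a ⊕_) (⨯-zeroˡ c) ⟩
    (b ∙ c) ⊙ a ⊕ 0₃           ≡⟨ ⊕-identityʳ ((b ∙ c) ⊙ a) ⟩
    (b ∙ c) ⊙ a                ∎

  normalised-≢⇒⨯≢0₃ : ∀ {t u} → Normalised₃ t → Normalised₃ u → t ≢ u → t ⨯ u ≢ 0₃
  normalised-≢⇒⨯≢0₃ {t} {u} t-normalised u-normalised t≢u t⨯u≡0 = t≢u (begin
    t          ≡⟨ ⊙-identityˡ t ⟨
    1# ⊙ t     ≡⟨ cong (_⊙ t) (normalised-scale≡1 t-normalised (subst Normalised₃ u≡k⊙t u-normalised)) ⟨
    k ⊙ t      ≡⟨ u≡k⊙t ⟨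
    u          ∎)
    where
    e : Carrier³
    e = proj₁ (normalised⇒pivot t-normalised)

    k : Carrier
    k = u ∙ e

    u≡k⊙t : u ≡ k ⊙ t
    u≡k⊙t = begin
      u            ≡⟨ ⊙-identityˡ u ⟨
      1# ⊙ u       ≡⟨ cong (_⊙ u) (proj₂ (normalised⇒pivot t-normalised)) ⟨
      (t ∙ e) ⊙ u  ≡⟨ ⨯≡0₃⇒proportional e t⨯u≡0 ⟩
      k ⊙ t        ∎

  ⊙-∙ : ∀ k t c → (k ⊙ t) ∙ c ≡ k * (t ∙ c)
  ⊙-∙ k (x , y , z) (c₁ , c₂ , c₃) =
    solve 7 (λ k x y z c₁ c₂ c₃ → let t = x , y , z; c = c₁ , c₂ , c₃ in
      (k P.⊙ t) P.∙ c := k :* (t P.∙ c))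
      refl k x y z c₁ c₂ c₃

  ∙-linear : ∀ p q r t u v c → (p ⊙ t ⊕ q ⊙ u ⊕ r ⊙ v) ∙ c ≡ p * (t ∙ c) + q * (u ∙ c) + r * (v ∙ c)
  ∙-linear p q r (t₁ , t₂ , t₃) (u₁ , u₂ , u₃) (v₁ , v₂ , v₃) (c₁ , c₂ , c₃) =
    solve 15 (λ p q r t₁ t₂ t₃ u₁ u₂ u₃ v₁ v₂ v₃ c₁ c₂ c₃ →
      let t = t₁ , t₂ , t₃; u = u₁ , u₂ , u₃; v = v₁ , v₂ , v₃; c = c₁ , c₂ , c₃ in
      (p P.⊙ t P.⊕ q P.⊙ u P.⊕ r P.⊙ v) P.∙ c := p :* (t P.∙ c) :+ q :* (u P.∙ c) :+ r :* (v P.∙ c))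
      refl p q r t₁ t₂ t₃ u₁ u₂ u₃ v₁ v₂ v₃ c₁ c₂ c₃

  ∙≢0⇒≢0₃ : ∀ {t} c → t ∙ c ≢ 0# → t ≢ 0₃
  ∙≢0⇒≢0₃ (c₁ , c₂ , c₃) 0₃∙c≢0 refl =
    0₃∙c≢0 (solve 3 (λ c₁ c₂ c₃ → (:0 , :0 , :0) P.∙ (c₁ , c₂ , c₃) := :0) refl c₁ c₂ c₃)

  ∙-separates : ∀ {t u} c → t ∙ c ≢ 0# → u ∙ c ≡ 0# → t ≢ u
  ∙-separates c t∙c≢0 u∙c≡0 refl = t∙c≢0 u∙c≡0

  ∙-⨯-selfˡ : ∀ t u → t ∙ (t ⨯ u) ≡ 0#
  ∙-⨯-selfˡ (t₁ , t₂ , t₃) (u₁ , u₂ , u₃) =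
    solve 6 (λ t₁ t₂ t₃ u₁ u₂ u₃ → let t = t₁ , t₂ , t₃; u = u₁ , u₂ , u₃ in
      t P.∙ (t P.⨯ u) := :0)
      refl t₁ t₂ t₃ u₁ u₂ u₃

  ∙-⨯-selfʳ : ∀ t u → u ∙ (t ⨯ u) ≡ 0#
  ∙-⨯-selfʳ (t₁ , t₂ , t₃) (u₁ , u₂ , u₃) =
    solve 6 (λ t₁ t₂ t₃ u₁ u₂ u₃ → let t = t₁ , t₂ , t₃; u = u₁ , u₂ , u₃ in
      u P.∙ (t P.⨯ u) := :0)
      refl t₁ t₂ t₃ u₁ u₂ u₃

  ∙-⨯-cyclic : ∀ t u v → u ∙ (v ⨯ t) ≡ (t ⨯ u) ∙ v
  ∙-⨯-cyclic (t₁ , t₂ , t₃) (u₁ , u₂ , u₃) (v₁ , v₂ , v₃) =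
    solve 9 (λ t₁ t₂ t₃ u₁ u₂ u₃ v₁ v₂ v₃ → let t = t₁ , t₂ , t₃; u = u₁ , u₂ , u₃; v = v₁ , v₂ , v₃ in
      u P.∙ (v P.⨯ t) := (t P.⨯ u) P.∙ v)
      refl t₁ t₂ t₃ u₁ u₂ u₃ v₁ v₂ v₃

  cramer₁ : ∀ p q r t u v → (p ⊙ t ⊕ q ⊙ u ⊕ r ⊙ v) ∙ (u ⨯ v) ≡ p * ((t ⨯ u) ∙ v)
  cramer₁ p q r (t₁ , t₂ , t₃) (u₁ , u₂ , u₃) (v₁ , v₂ , v₃) =
    solve 12 (λ p q r t₁ t₂ t₃ u₁ u₂ u₃ v₁ v₂ v₃ →
      let t = t₁ , t₂ , t₃; u = u₁ , u₂ , u₃; v = v₁ , v₂ , v₃ in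
      (p P.⊙ t P.⊕ q P.⊙ u P.⊕ r P.⊙ v) P.∙ (u P.⨯ v) := p :* ((t P.⨯ u) P.∙ v))
      refl p q r t₁ t₂ t₃ u₁ u₂ u₃ v₁ v₂ v₃

  cramer₂ : ∀ p q r t u v → (p ⊙ t ⊕ q ⊙ u ⊕ r ⊙ v) ∙ (v ⨯ t) ≡ q * ((t ⨯ u) ∙ v)
  cramer₂ p q r (t₁ , t₂ , t₃) (u₁ , u₂ , u₃) (v₁ , v₂ , v₃) =
    solve 12 (λ p q r t₁ t₂ t₃ u₁ u₂ u₃ v₁ v₂ v₃ →
      let t = t₁ , t₂ , t₃; u = u₁ , u₂ , u₃; v = v₁ , v₂ , v₃ in
      (p P.⊙ t P.⊕ q P.⊙ u P.⊕ r P.⊙ v) P.∙ (v P.⨯ t) := q :* ((t P.⨯ u) P.∙ v))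
      refl p q r t₁ t₂ t₃ u₁ u₂ u₃ v₁ v₂ v₃

  cramer₃ : ∀ p q r t u v → (p ⊙ t ⊕ q ⊙ u ⊕ r ⊙ v) ∙ (t ⨯ u) ≡ r * ((t ⨯ u) ∙ v)
  cramer₃ p q r (t₁ , t₂ , t₃) (u₁ , u₂ , u₃) (v₁ , v₂ , v₃) =
    solve 12 (λ p q r t₁ t₂ t₃ u₁ u₂ u₃ v₁ v₂ v₃ →
      let t = t₁ , t₂ , t₃; u = u₁ , u₂ , u₃; v = v₁ , v₂ , v₃ in
      (p P.⊙ t P.⊕ q P.⊙ u P.⊕ r P.⊙ v) P.∙ (t P.⨯ u) := r :* ((t P.⨯ u) P.∙ v))
      refl p q r t₁ t₂ t₃ u₁ u₂ u₃ v₁ v₂ v₃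

  -- Symmetric 3×3 matrices

  v6-cong : ∀ {a b c d e f a′ b′ c′ d′ e′ f′} →
            a ≡ a′ → b ≡ b′ → c ≡ c′ → d ≡ d′ → e ≡ e′ → f ≡ f′ →
            v6 a b c d e f ≡ v6 a′ b′ c′ d′ e′ f′
  v6-cong refl refl refl refl refl refl = refl

  IsZeroMat⇒≡zeroV : ∀ m → IsZeroMat m → m ≡ zeroV
  IsZeroMat⇒≡zeroV (v6 a b c d e f) (a≡0 , b≡0 , c≡0 , d≡0 , e≡0 , f≡0) =
    v6-cong a≡0 b≡0 c≡0 d≡0 e≡0 f≡0

  ·-assoc : ∀ j k m → (j * k) · m ≡ j · (k · m)
  ·-assoc j k (v6 a b c d e f) =
    v6-cong (*-assoc j k a) (*-assoc j k b) (*-assoc j k c) (*-assoc j k d) (*-assoc j k e) (*-assoc j k f)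

  outer-⊙ : ∀ k t → outer (k ⊙ t) ≡ (k * k) · outer t
  outer-⊙ k (x , y , z) = v6-cong (kk x x) (kk x y) (kk x z) (kk y y) (kk y z) (kk z z)
    where
    kk : ∀ u v → k * u * (k * v) ≡ k * k * (u * v)
    kk = solve 3 (λ k u v → k :* u :* (k :* v) := k :* k :* (u :* v)) refl k

  det-scale : ∀ k m → det (k · m) ≡ k * k * k * det m
  det-scale k (v6 a b c d e f) =
    solve 7 (λ k a b c d e f → let m = sym3 a b c d e f in
      P.detₘ (k P.·ₘ m) := k :* k :* k :* P.detₘ m)
      refl k a b c d e f

  det-adj : ∀ m → det (adj m) ≡ det m * det m
  det-adj (v6 a b c d e f) =
    solve 6 (λ a b c d e f → let m = sym3 a b c d e f in
      P.detₘ (P.adj m) := P.detₘ m :* P.detₘ m)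
      refl a b c d e f

  det-gram : ∀ n u v w → det (gram n u v w) ≡ ((u ⨯ v) ∙ w) * ((u ⨯ v) ∙ w) * det n
  det-gram (v6 n₁ n₂ n₃ n₄ n₅ n₆) (u₁ , u₂ , u₃) (v₁ , v₂ , v₃) (w₁ , w₂ , w₃) =
    solve 15 (λ n₁ n₂ n₃ n₄ n₅ n₆ u₁ u₂ u₃ v₁ v₂ v₃ w₁ w₂ w₃ →
      let n = sym3 n₁ n₂ n₃ n₄ n₅ n₆; u = u₁ , u₂ , u₃; v = v₁ , v₂ , v₃; w = w₁ , w₂ , w₃ in
      P.detₘ (P.gram n u v w) := ((u P.⨯ v) P.∙ w) :* ((u P.⨯ v) P.∙ w) :* P.detₘ n)
      refl n₁ n₂ n₃ n₄ n₅ n₆ u₁ u₂ u₃ v₁ v₂ v₃ w₁ w₂ w₃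

  det-isotropic : ∀ x y z → det (v6 0# 0# x 0# y z) ≡ 0#
  det-isotropic = solve 3 (λ x y z → P.detₘ (sym3 :0 :0 x :0 y z) := :0) refl

  form-adj-jacobi : ∀ m u v → form (adj m) u v * form (adj m) u v ≡
    form (adj m) u u * form (adj m) v v - det m * form m (u ⨯ v) (u ⨯ v)
  form-adj-jacobi (v6 a b c d e f) (u₁ , u₂ , u₃) (v₁ , v₂ , v₃) =
    solve 12 (λ a b c d e f u₁ u₂ u₃ v₁ v₂ v₃ →
      let m = sym3 a b c d e f; u = u₁ , u₂ , u₃; v = v₁ , v₂ , v₃ in
      P.form (P.adj m) u v :* P.form (P.adj m) u v :=
      P.form (P.adj m) u u :* P.form (P.adj m) v v :- P.detₘ m :* P.form m (u P.⨯ v) (u P.⨯ v))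
      refl a b c d e f u₁ u₂ u₃ v₁ v₂ v₃

  det-rank-two : ∀ x y u v m → det (((x · outer u) +V (y · outer v)) +V (0# · m)) ≡ 0#
  det-rank-two x y (u₁ , u₂ , u₃) (v₁ , v₂ , v₃) (v6 a b c d e f) =
    solve 14 (λ x y u₁ u₂ u₃ v₁ v₂ v₃ a b c d e f →
      let m = sym3 a b c d e f; u = u₁ , u₂ , u₃; v = v₁ , v₂ , v₃ in
      P.detₘ ((x P.·ₘ P.outer u P.+ₘ y P.·ₘ P.outer v) P.+ₘ :0 P.·ₘ m) := :0)
      refl x y u₁ u₂ u₃ v₁ v₂ v₃ a b c d e f

  det-rank-one-update : ∀ x y u v m → det (((x · outer u) +V (y · outer v)) +V (1# · m)) ≡
    det m + x * form (adj m) u u + y * form (adj m) v v + x * y * form m (u ⨯ v) (u ⨯ v)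
  det-rank-one-update x y (u₁ , u₂ , u₃) (v₁ , v₂ , v₃) (v6 a b c d e f) =
    solve 14 (λ x y u₁ u₂ u₃ v₁ v₂ v₃ a b c d e f →
      let m = sym3 a b c d e f; u = u₁ , u₂ , u₃; v = v₁ , v₂ , v₃ in
      P.detₘ ((x P.·ₘ P.outer u P.+ₘ y P.·ₘ P.outer v) P.+ₘ :1 P.·ₘ m) :=
      P.detₘ m :+ x :* P.form (P.adj m) u u :+ y :* P.form (P.adj m) v v
        :+ x :* y :* P.form m (u P.⨯ v) (u P.⨯ v))
      refl x y u₁ u₂ u₃ v₁ v₂ v₃ a b c d e f

  isotropic⇒singular : ∀ {u v c} m → (u ⨯ v) ∙ c ≢ 0# →
    form (adj m) u u ≡ 0# → form (adj m) v v ≡ 0# → form m (u ⨯ v) (u ⨯ v) ≡ 0# → det m ≡ 0#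
  isotropic⇒singular {u} {v} {c} m [uvc]≢0 uu≡0 vv≡0 ww≡0 =
    x*x≡0⇒x≡0 (trans (sym (det-adj m)) (x*y≡0⇒y≡0 (*-≢0 [uvc]≢0 [uvc]≢0) (begin
      (u ⨯ v) ∙ c * ((u ⨯ v) ∙ c) * det (adj m)  ≡⟨ det-gram (adj m) u v c ⟨
      det (gram (adj m) u v c)                     ≡⟨ cong det (v6-cong uu≡0 uv≡0 refl vv≡0 refl refl) ⟩
      det (v6 0# 0# _ 0# _ _)                      ≡⟨ det-isotropic _ _ _ ⟩
      0#                                           ∎)))
    where
    uv≡0 : form (adj m) u v ≡ 0#
    uv≡0 = x*x≡0⇒x≡0 (begin
      form (adj m) u v * form (adj m) u v                         ≡⟨ form-adj-jacobi m u v ⟩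
      form (adj m) u u * form (adj m) v v - det m * form m (u ⨯ v) (u ⨯ v)
                                                                  ≡⟨ cong₂ (λ p q → p - det m * q) (cong₂ _*_ uu≡0 vv≡0) ww≡0 ⟩
      0# * 0# - det m * 0#                                        ≡⟨ solve 1 (λ d → :0 :* :0 :- d :* :0 := :0) refl (det m) ⟩
      0#                                                          ∎)

  rank≡1-elim : ∀ m → rank m ≡ 1 → ¬ IsZeroMat m × allZero (minors m)
  rank≡1-elim m rank≡1 with isZeroMat? m
  ... | yes _ with () ← rank≡1
  ... | no m≢0 with allZero? (minors m)
  ...   | yes minors≡0 = m≢0 , minors≡0
  ...   | no _ with det m ≟ 0#
  ...     | yes _ with () ← rank≡1
  ...     | no _  with () ← rank≡1

  rank≡1-intro : ∀ m → ¬ IsZeroMat m → allZero (minors m) → rank m ≡ 1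
  rank≡1-intro m m≢0 minors≡0 with isZeroMat? m
  ... | yes m≡0 = ⊥-elim (m≢0 m≡0)
  ... | no _ with allZero? (minors m)
  ...   | yes _ = refl
  ...   | no minors≢0 = ⊥-elim (minors≢0 minors≡0)

  rank≡2-intro : ∀ m → ¬ IsZeroMat m → ¬ allZero (minors m) → det m ≡ 0# → rank m ≡ 2
  rank≡2-intro m m≢0 minors≢0 det≡0 with isZeroMat? m
  ... | yes m≡0 = ⊥-elim (m≢0 m≡0)
  ... | no _ with allZero? (minors m)
  ...   | yes minors≡0 = ⊥-elim (minors≢0 minors≡0)
  ...   | no _ with det m ≟ 0#
  ...     | yes _ = refl
  ...     | no det≢0 = ⊥-elim (det≢0 det≡0)

  minors≡0⇒outer : ∀ m → ¬ IsZeroMat m → allZero (minors m) →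
                   ∃₂ λ k t → k ≢ 0# × t ≢ 0₃ × k · m ≡ outer t
  minors≡0⇒outer (v6 a b c d e f) m≢0 (ad≡bb , _ , be≡cd , ae≡bc , af≡cc , bf≡ce , _ , _ , df≡ee , _)
    with a ≟ 0# | d ≟ 0# | f ≟ 0#
  ... | no a≢0 | _ | _ = a , (a , b , c) , a≢0 , (λ t≡0 → a≢0 (cong proj₁ t≡0)) ,
      v6-cong refl refl refl (x-y≡0⇒x≡y _ _ ad≡bb) (x-y≡0⇒x≡y _ _ ae≡bc) (x-y≡0⇒x≡y _ _ af≡cc)
  ... | yes refl | no d≢0 | _ = d , (b , d , e) , d≢0 , (λ t≡0 → d≢0 (cong (proj₁ ∘ proj₂) t≡0)) ,
      v6-cong (trans (*-comm d 0#) (x-y≡0⇒x≡y _ _ ad≡bb)) (*-comm d b) (trans (*-comm d c) (sym (x-y≡0⇒x≡y _ _ be≡cd)))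
              refl refl (x-y≡0⇒x≡y _ _ df≡ee)
  ... | yes refl | yes refl | no f≢0 = f , (c , e , f) , f≢0 , (λ t≡0 → f≢0 (cong (proj₂ ∘ proj₂) t≡0)) ,
      v6-cong (trans (*-comm f 0#) (x-y≡0⇒x≡y _ _ af≡cc)) (trans (*-comm f b) (x-y≡0⇒x≡y _ _ bf≡ce)) (*-comm f c)
              (trans (*-comm f 0#) (x-y≡0⇒x≡y _ _ df≡ee)) (*-comm f e) refl
  ... | yes refl | yes refl | yes refl = ⊥-elim (m≢0 (refl , b≡0 , c≡0 , refl , e≡0 , refl))
    where
    square≡0 : ∀ {x} → 0# * 0# - x * x ≡ 0# → x ≡ 0#
    square≡0 {x} eq = x*x≡0⇒x≡0 (trans (sym (x-y≡0⇒x≡y _ _ eq)) (zeroˡ 0#))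
    b≡0 : b ≡ 0#
    b≡0 = square≡0 ad≡bb
    c≡0 : c ≡ 0#
    c≡0 = square≡0 af≡cc
    e≡0 : e ≡ 0#
    e≡0 = square≡0 df≡ee

  rank≡1⇒outer : ∀ m → rank m ≡ 1 → ∃₂ λ k t → k ≢ 0# × t ≢ 0₃ × k · m ≡ outer t
  rank≡1⇒outer m rank≡1 = minors≡0⇒outer m (proj₁ (rank≡1-elim m rank≡1)) (proj₂ (rank≡1-elim m rank≡1))

  -- Enumeration of the points of a plane

  triples≡cartesianProduct : triples ≡ cartesianProduct elements (cartesianProduct elements elements)
  triples≡cartesianProduct = begin
    concatMap (λ x → concatMap (λ y → map (λ z → x , y , z) elements) elements) elements
      ≡⟨ List.concatMap-cong rows elements ⟩
    concatMap (λ x → map (x ,_) (cartesianProduct elements elements)) elements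
      ≡⟨ concatMap-map≡cartesianProductWith _,_ elements _ ⟩
    cartesianProduct elements (cartesianProduct elements elements)
      ∎
    where
    rows : ∀ x → concatMap (λ y → map (λ z → x , y , z) elements) elements ≡
                 map (x ,_) (cartesianProduct elements elements)
    rows x = begin
      concatMap (λ y → map (λ z → x , y , z) elements) elements
        ≡⟨ List.concatMap-cong (λ y → List.map-∘ elements) elements ⟩
      concatMap (λ y → map (x ,_) (map (y ,_) elements)) elements
        ≡⟨ List.map-concatMap (x ,_) (λ y → map (y ,_) elements) elements ⟨
      map (x ,_) (concatMap (λ y → map (y ,_) elements) elements)
        ≡⟨ cong (map (x ,_)) (concatMap-map≡cartesianProductWith _,_ elements elements) ⟩
      map (x ,_) (cartesianProduct elements elements)
        ∎

  normTriples-unique : Unique normTriples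
  normTriples-unique = Unique.filter⁺ _ (subst Unique (sym triples≡cartesianProduct)
    (Unique.cartesianProduct⁺ elements-unique (Unique.cartesianProduct⁺ elements-unique elements-unique)))

  normalised⇒∈normTriples : ∀ {t} → Normalised₃ t → t ∈ normTriples
  normalised⇒∈normTriples {x , y , z} t-normalised = ∈-filter⁺ _ (subst (_ ∈_) (sym triples≡cartesianProduct)
    (∈-cartesianProduct⁺ (elements-complete x) (∈-cartesianProduct⁺ (elements-complete y) (elements-complete z))))
    t-normalised

  ∈normTriples⇒normalised : ∀ {t} → t ∈ normTriples → Normalised₃ t
  ∈normTriples⇒normalised t∈ = proj₂ (∈-filter⁻ {P = Normalised₃} _ {xs = triples} t∈)

  module Plane (u₁ u₂ u₃ : Vec6) (independent : LinearlyIndependent u₁ u₂ u₃) where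

    point : Carrier³ → Vec6
    point (x , y , z) = comb u₁ u₂ u₃ x y z

    point-⊙ : ∀ k t → point (k ⊙ t) ≡ k · point t
    point-⊙ k t = v6-cong (⊙-∙ k t _) (⊙-∙ k t _) (⊙-∙ k t _) (⊙-∙ k t _) (⊙-∙ k t _) (⊙-∙ k t _)

    point-linear : ∀ p q r t u v → point (p ⊙ t ⊕ q ⊙ u ⊕ r ⊙ v) ≡ ((p · point t) +V (q · point u)) +V (r · point v)
    point-linear p q r t u v = v6-cong (∙-linear p q r t u v _) (∙-linear p q r t u v _) (∙-linear p q r t u v _)
                                       (∙-linear p q r t u v _) (∙-linear p q r t u v _) (∙-linear p q r t u v _)

    point-injective : ∀ {t u} → point t ≡ point u → t ≡ u
    point-injective {t} {u} point-t≡point-u =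
      let dx≡0 , dy≡0 , dz≡0 = independent (proj₁ d) (proj₁ (proj₂ d)) (proj₂ (proj₂ d)) point-d≡0
      in triple-cong (difference≡0 dx≡0) (difference≡0 dy≡0) (difference≡0 dz≡0)
      where
      d : Carrier³
      d = 1# ⊙ t ⊕ (- 1#) ⊙ u ⊕ 0# ⊙ u

      cancel : ∀ w → 1# * w + - 1# * w + 0# * w ≡ 0#
      cancel = solve 1 (λ w → :1 :* w :+ :- :1 :* w :+ :0 :* w := :0) refl

      point-d≡0 : point d ≡ zeroV
      point-d≡0 = begin
        point d                                                      ≡⟨ point-linear 1# (- 1#) 0# t u u ⟩
        ((1# · point t) +V ((- 1#) · point u)) +V (0# · point u)     ≡⟨ cong (λ m → ((1# · m) +V ((- 1#) · point u)) +V (0# · point u)) point-t≡point-u ⟩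
        ((1# · point u) +V ((- 1#) · point u)) +V (0# · point u)     ≡⟨ v6-cong (cancel _) (cancel _) (cancel _) (cancel _) (cancel _) (cancel _) ⟩
        zeroV                                                        ∎

      difference≡0 : ∀ {w w′} → 1# * w + - 1# * w′ + 0# * w′ ≡ 0# → w ≡ w′
      difference≡0 {w} {w′} d≡0 = x-y≡0⇒x≡y w w′
        (trans (solve 2 (λ w w′ → w :- w′ := :1 :* w :+ :- :1 :* w′ :+ :0 :* w′) refl w w′) d≡0)

    point-≢0 : ∀ {t} → t ≢ 0₃ → ¬ IsZeroMat (point t)
    point-≢0 {x , y , z} t≢0 point≡0 with independent x y z (IsZeroMat⇒≡zeroV _ point≡0)
    ... | x≡0 , y≡0 , z≡0 = t≢0 (triple-cong x≡0 y≡0 z≡0)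

    det-point-⊙ : ∀ k t → det (point (k ⊙ t)) ≡ k * k * k * det (point t)
    det-point-⊙ k t = trans (cong det (point-⊙ k t)) (det-scale k (point t))

    rank-one-points : rankCount u₁ u₂ u₃ 1 ≡ 2 → ∃₂ λ t₁ t₂ → t₁ ≢ t₂ ×
      (Normalised₃ t₁ × rank (point t₁) ≡ 1) × (Normalised₃ t₂ × rank (point t₂) ≡ 1) ×
      (∀ {t} → Normalised₃ t → rank (point t) ≡ 1 → t ≡ t₁ ⊎ t ≡ t₂)
    rank-one-points count≡2
      with t₁ , t₂ , t₁≢t₂ , (t₁∈ , rank-t₁) , (t₂∈ , rank-t₂) , among ←
           filter-length≡2 {P = λ t → rank (point t) ≡ 1} _ normTriples-unique count≡2
      = t₁ , t₂ , t₁≢t₂ , (∈normTriples⇒normalised t₁∈ , rank-t₁) , (∈normTriples⇒normalised t₂∈ , rank-t₂) ,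
        λ t-normalised → among (normalised⇒∈normTriples t-normalised)

    injection⇒order≤rankCount₂ : (g : Carrier → Carrier³) → (∀ {s s′} → g s ≡ g s′ → s ≡ s′) →
      (∀ s → Normalised₃ (g s) × rank (point (g s)) ≡ 2) → order ≤ rankCount u₁ u₂ u₃ 2
    injection⇒order≤rankCount₂ g g-injective g-rank₂ =
      subst (_≤ rankCount u₁ u₂ u₃ 2) (List.length-map g elements)
        (Unique⇒length≤filter {P = λ t → rank (point t) ≡ 2} _
          (Unique.map⁺ g-injective elements-unique) image⊆)
      where
      image⊆ : ∀ {t} → t ∈ map g elements → t ∈ normTriples × rank (point t) ≡ 2
      image⊆ t∈ with s , _ , refl ← ∈-map⁻ g t∈ =
        normalised⇒∈normTriples (proj₁ (g-rank₂ s)) , proj₂ (g-rank₂ s)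

    module TwoRankOnePoints
      {t₁ t₂ : Carrier³} (only-t₁-t₂ : ∀ {t} → Normalised₃ t → rank (point t) ≡ 1 → t ≡ t₁ ⊎ t ≡ t₂)
      {k₁ k₂ : Carrier} {a b : Carrier³} (k₁≢0 : k₁ ≢ 0#) (k₂≢0 : k₂ ≢ 0#) (a≢0 : a ≢ 0₃)
      (k₁·t₁≡aa : k₁ · point t₁ ≡ outer a) (k₂·t₂≡bb : k₂ · point t₂ ≡ outer b)
      {e : Carrier³} (W≢0 : (t₁ ⨯ t₂) ∙ e ≢ 0#) where

      -- By Cramer's rule the functionals
      -- _∙ (t₂ ⨯ e), _∙ (e ⨯ t₁) and _∙ (t₁ ⨯ t₂) read off its coordinates times W, and this is
      -- how the points constructed below are told apart.
      W : Carrier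
      W = (t₁ ⨯ t₂) ∙ e

      M : Vec6
      M = point e

      T : Carrier → Carrier → Carrier → Carrier³
      T x y z = (x * k₁) ⊙ t₁ ⊕ (y * k₂) ⊙ t₂ ⊕ z ⊙ e

      point-T : ∀ x y z → point (T x y z) ≡ ((x · outer a) +V (y · outer b)) +V (z · M)
      point-T x y z = begin
        point (T x y z)
          ≡⟨ point-linear (x * k₁) (y * k₂) z t₁ t₂ e ⟩
        (((x * k₁) · point t₁) +V ((y * k₂) · point t₂)) +V (z · M)
          ≡⟨ cong₂ (λ A B → (A +V B) +V (z · M))
               (trans (·-assoc x k₁ (point t₁)) (cong (x ·_) k₁·t₁≡aa))
               (trans (·-assoc y k₂ (point t₂)) (cong (y ·_) k₂·t₂≡bb)) ⟩
        ((x · outer a) +V (y · outer b)) +V (z · M)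
          ∎

      ⊙T-∙ : ∀ k x y z c {v} → T x y z ∙ c ≡ v → (k ⊙ T x y z) ∙ c ≡ k * v
      ⊙T-∙ k x y z c T∙c≡v = trans (⊙-∙ k (T x y z) c) (cong (k *_) T∙c≡v)

      κ₁-T : ∀ x y z → T x y z ∙ (t₂ ⨯ e) ≡ x * k₁ * W
      κ₁-T x y z = cramer₁ (x * k₁) (y * k₂) z t₁ t₂ e

      κ₂-T : ∀ x y z → T x y z ∙ (e ⨯ t₁) ≡ y * k₂ * W
      κ₂-T x y z = cramer₂ (x * k₁) (y * k₂) z t₁ t₂ e

      ω-T : ∀ x y z → T x y z ∙ (t₁ ⨯ t₂) ≡ z * W
      ω-T x y z = cramer₃ (x * k₁) (y * k₂) z t₁ t₂ e

      line-point : ∀ s → ∃ λ k → k ≢ 0# × Normalised₃ (k ⊙ T 1# s 0#)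
      line-point s = normalise (T 1# s 0#)
        (∙≢0⇒≢0₃ (t₂ ⨯ e) (λ κ₁≡0 → *-≢0 (*-≢0 1≢0 k₁≢0) W≢0 (trans (sym (κ₁-T 1# s 0#)) κ₁≡0)))

      L : Carrier → Carrier³
      L s = proj₁ (line-point s) ⊙ T 1# s 0#

      a⨯b≢0₃ : a ⨯ b ≢ 0₃
      a⨯b≢0₃ a⨯b≡0 with c , a∙c≢0 ← ≢0₃⇒∃∙≢0 a a≢0 = *-≢0 (*-≢0 a∙c≢0 a∙c≢0) k₂≢0 coefficient≡0
        where
        μ ν : Carrier
        μ = a ∙ c
        ν = b ∙ c

        proportional : (μ * μ * k₂) · point t₂ ≡ (ν * ν * k₁) · point t₁
        proportional = begin
          (μ * μ * k₂) · point t₂    ≡⟨ ·-assoc (μ * μ) k₂ (point t₂) ⟩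
          (μ * μ) · (k₂ · point t₂)  ≡⟨ cong ((μ * μ) ·_) k₂·t₂≡bb ⟩
          (μ * μ) · outer b          ≡⟨ outer-⊙ μ b ⟨
          outer (μ ⊙ b)              ≡⟨ cong outer (⨯≡0₃⇒proportional c a⨯b≡0) ⟩
          outer (ν ⊙ a)              ≡⟨ outer-⊙ ν a ⟩
          (ν * ν) · outer a          ≡⟨ cong ((ν * ν) ·_) k₁·t₁≡aa ⟨
          (ν * ν) · (k₁ · point t₁)  ≡⟨ ·-assoc (ν * ν) k₁ (point t₁) ⟨
          (ν * ν * k₁) · point t₁    ∎

        coefficient≡0 : μ * μ * k₂ ≡ 0#
        coefficient≡0 = *-cancelʳ W≢0 (begin
          μ * μ * k₂ * W                       ≡⟨ cong (μ * μ * k₂ *_) (∙-⨯-cyclic t₁ t₂ e) ⟨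
          μ * μ * k₂ * (t₂ ∙ (e ⨯ t₁))         ≡⟨ ⊙-∙ (μ * μ * k₂) t₂ (e ⨯ t₁) ⟨
          ((μ * μ * k₂) ⊙ t₂) ∙ (e ⨯ t₁)       ≡⟨ cong (_∙ (e ⨯ t₁)) (point-injective
                                                    (trans (point-⊙ _ t₂) (trans proportional (sym (point-⊙ _ t₁))))) ⟩
          ((ν * ν * k₁) ⊙ t₁) ∙ (e ⨯ t₁)       ≡⟨ ⊙-∙ (ν * ν * k₁) t₁ (e ⨯ t₁) ⟩
          ν * ν * k₁ * (t₁ ∙ (e ⨯ t₁))         ≡⟨ cong (ν * ν * k₁ *_) (∙-⨯-selfʳ e t₁) ⟩
          ν * ν * k₁ * 0#                      ≡⟨ zeroʳ _ ⟩
          0#                                   ≡⟨ zeroˡ W ⟨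
          0# * W                               ∎)

      α β γ : Carrier
      α = form (adj M) a a
      β = form (adj M) b b
      γ = form M (a ⨯ b) (a ⨯ b)

      off-line-root : ∃₂ λ x y → det M + x * α + y * β + x * y * γ ≡ 0#
      off-line-root = bilinear-root α β γ (det M) M-singular
        where
        M-singular : α ≡ 0# → β ≡ 0# → γ ≡ 0# → det M ≡ 0#
        M-singular = isotropic⇒singular {a} {b} {proj₁ witness} M (proj₂ witness)
          where
          witness : ∃ λ c → (a ⨯ b) ∙ c ≢ 0#
          witness = ≢0₃⇒∃∙≢0 (a ⨯ b) a⨯b≢0₃

      x₀ y₀ : Carrier
      x₀ = proj₁ off-line-root
      y₀ = proj₁ (proj₂ off-line-root)

      off-line-point : ∃ λ k → k ≢ 0# × Normalised₃ (k ⊙ T x₀ y₀ 1#)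
      off-line-point = normalise (T x₀ y₀ 1#)
        (∙≢0⇒≢0₃ (t₁ ⨯ t₂) (λ ω≡0 → *-≢0 1≢0 W≢0 (trans (sym (ω-T x₀ y₀ 1#)) ω≡0)))

      P₀ : Carrier³
      P₀ = proj₁ off-line-point ⊙ T x₀ y₀ 1#

      det-L : ∀ s → det (point (L s)) ≡ 0#
      det-L s = begin
        det (point (k ⊙ T 1# s 0#))                                     ≡⟨ det-point-⊙ k _ ⟩
        k * k * k * det (point (T 1# s 0#))                              ≡⟨ cong (λ m → k * k * k * det m) (point-T 1# s 0#) ⟩
        k * k * k * det (((1# · outer a) +V (s · outer b)) +V (0# · M))  ≡⟨ cong (k * k * k *_) (det-rank-two 1# s a b M) ⟩
        k * k * k * 0#                                                   ≡⟨ zeroʳ _ ⟩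
        0#                                                               ∎
        where
        k : Carrier
        k = proj₁ (line-point s)

      det-P₀ : det (point P₀) ≡ 0#
      det-P₀ = begin
        det (point (k ⊙ T x₀ y₀ 1#))                                       ≡⟨ det-point-⊙ k _ ⟩
        k * k * k * det (point (T x₀ y₀ 1#))                                ≡⟨ cong (λ m → k * k * k * det m) (point-T x₀ y₀ 1#) ⟩
        k * k * k * det (((x₀ · outer a) +V (y₀ · outer b)) +V (1# · M))    ≡⟨ cong (k * k * k *_) (det-rank-one-update x₀ y₀ a b M) ⟩
        k * k * k * (det M + x₀ * α + y₀ * β + x₀ * y₀ * γ)                ≡⟨ cong (k * k * k *_) (proj₂ (proj₂ off-line-root)) ⟩
        k * k * k * 0#                                                      ≡⟨ zeroʳ _ ⟩
        0#                                                                  ∎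
        where
        k : Carrier
        k = proj₁ off-line-point

      L≢t₁ : ∀ {s} → s ≢ 0# → L s ≢ t₁
      L≢t₁ {s} s≢0 = ∙-separates (e ⨯ t₁)
        (λ κ₂≡0 → *-≢0 (proj₁ (proj₂ (line-point s))) (*-≢0 (*-≢0 s≢0 k₂≢0) W≢0)
                    (trans (sym (⊙T-∙ _ 1# s 0# (e ⨯ t₁) (κ₂-T 1# s 0#))) κ₂≡0))
        (∙-⨯-selfʳ e t₁)

      L≢t₂ : ∀ s → L s ≢ t₂
      L≢t₂ s = ∙-separates (t₂ ⨯ e)
        (λ κ₁≡0 → *-≢0 (proj₁ (proj₂ (line-point s))) (*-≢0 (*-≢0 1≢0 k₁≢0) W≢0)
                    (trans (sym (⊙T-∙ _ 1# s 0# (t₂ ⨯ e) (κ₁-T 1# s 0#))) κ₁≡0))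
        (∙-⨯-selfˡ t₂ e)

      ω-P₀≢0 : P₀ ∙ (t₁ ⨯ t₂) ≢ 0#
      ω-P₀≢0 ω≡0 = *-≢0 (proj₁ (proj₂ off-line-point)) (*-≢0 1≢0 W≢0)
        (trans (sym (⊙T-∙ _ x₀ y₀ 1# (t₁ ⨯ t₂) (ω-T x₀ y₀ 1#))) ω≡0)

      P₀≢L : ∀ s → P₀ ≢ L s
      P₀≢L s = ∙-separates (t₁ ⨯ t₂) ω-P₀≢0
        (trans (⊙T-∙ k 1# s 0# (t₁ ⨯ t₂) (ω-T 1# s 0#)) (trans (cong (k *_) (zeroˡ W)) (zeroʳ k)))
        where
        k : Carrier
        k = proj₁ (line-point s)

      L-injective : ∀ {s s′} → L s ≡ L s′ → s ≡ s′
      L-injective {s} {s′} Ls≡Ls′ = *-cancelʳ k₂≢0 (*-cancelʳ W≢0 (*-cancelˡ (proj₁ (proj₂ (line-point s))) (begin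
        k * (s * k₂ * W)         ≡⟨ ⊙T-∙ k 1# s 0# (e ⨯ t₁) (κ₂-T 1# s 0#) ⟨
        L s ∙ (e ⨯ t₁)           ≡⟨ cong (_∙ (e ⨯ t₁)) Ls≡Ls′ ⟩
        L s′ ∙ (e ⨯ t₁)          ≡⟨ ⊙T-∙ k′ 1# s′ 0# (e ⨯ t₁) (κ₂-T 1# s′ 0#) ⟩
        k′ * (s′ * k₂ * W)       ≡⟨ cong (_* (s′ * k₂ * W)) k≡k′ ⟨
        k * (s′ * k₂ * W)        ∎)))
        where
        k k′ : Carrier
        k = proj₁ (line-point s)
        k′ = proj₁ (line-point s′)
        k≡k′ : k ≡ k′
        k≡k′ = *-cancelʳ (*-≢0 (*-≢0 1≢0 k₁≢0) W≢0) (begin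
          k * (1# * k₁ * W)       ≡⟨ ⊙T-∙ k 1# s 0# (t₂ ⨯ e) (κ₁-T 1# s 0#) ⟨
          L s ∙ (t₂ ⨯ e)          ≡⟨ cong (_∙ (t₂ ⨯ e)) Ls≡Ls′ ⟩
          L s′ ∙ (t₂ ⨯ e)         ≡⟨ ⊙T-∙ k′ 1# s′ 0# (t₂ ⨯ e) (κ₁-T 1# s′ 0#) ⟩
          k′ * (1# * k₁ * W)      ∎)

      rank≡2 : ∀ {P} → Normalised₃ P → det (point P) ≡ 0# → P ≢ t₁ → P ≢ t₂ → rank (point P) ≡ 2
      rank≡2 {P} P-normalised det≡0 P≢t₁ P≢t₂ = rank≡2-intro (point P) point≢0 not-rank-one det≡0
        where
        point≢0 : ¬ IsZeroMat (point P)
        point≢0 = point-≢0 (normalised⇒≢0₃ P-normalised)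
        not-rank-one : ¬ allZero (minors (point P))
        not-rank-one minors≡0 with only-t₁-t₂ P-normalised (rank≡1-intro (point P) point≢0 minors≡0)
        ... | inj₁ P≡t₁ = P≢t₁ P≡t₁
        ... | inj₂ P≡t₂ = P≢t₂ P≡t₂

      g : Carrier → Carrier³
      g s with s ≟ 0#
      ... | yes _ = P₀
      ... | no  _ = L s

      g-injective : ∀ {s s′} → g s ≡ g s′ → s ≡ s′
      g-injective {s} {s′} with s ≟ 0# | s′ ≟ 0#
      ... | yes s≡0 | yes s′≡0 = λ _ → trans s≡0 (sym s′≡0)
      ... | yes _   | no  _    = λ P₀≡L → ⊥-elim (P₀≢L s′ P₀≡L)
      ... | no  _   | yes _    = λ L≡P₀ → ⊥-elim (P₀≢L s (sym L≡P₀))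
      ... | no  _   | no  _    = L-injective

      g-rank₂ : ∀ s → Normalised₃ (g s) × rank (point (g s)) ≡ 2
      g-rank₂ s with s ≟ 0#
      ... | yes _ = P₀-normalised , rank≡2 P₀-normalised det-P₀
                      (∙-separates (t₁ ⨯ t₂) ω-P₀≢0 (∙-⨯-selfˡ t₁ t₂))
                      (∙-separates (t₁ ⨯ t₂) ω-P₀≢0 (∙-⨯-selfʳ t₁ t₂))
        where
        P₀-normalised : Normalised₃ P₀
        P₀-normalised = proj₂ (proj₂ off-line-point)
      ... | no s≢0 = L-normalised , rank≡2 L-normalised (det-L s) (L≢t₁ s≢0) (L≢t₂ s)
        where
        L-normalised : Normalised₃ (L s)
        L-normalised = proj₂ (proj₂ (line-point s))

      order≤rankCount₂ : order ≤ rankCount u₁ u₂ u₃ 2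
      order≤rankCount₂ = injection⇒order≤rankCount₂ g g-injective g-rank₂

    rankCount₁≡2⇒order≤rankCount₂ : rankCount u₁ u₂ u₃ 1 ≡ 2 → order ≤ rankCount u₁ u₂ u₃ 2
    rankCount₁≡2⇒order≤rankCount₂ count≡2 =
      let t₁ , t₂ , t₁≢t₂ , (t₁-normalised , rank-t₁) , (t₂-normalised , rank-t₂) , only-t₁-t₂ =
            rank-one-points count≡2
          k₁ , a , k₁≢0 , a≢0 , k₁·t₁≡aa = rank≡1⇒outer (point t₁) rank-t₁
          k₂ , b , k₂≢0 , _ , k₂·t₂≡bb = rank≡1⇒outer (point t₂) rank-t₂
          e , W≢0 = ≢0₃⇒∃∙≢0 (t₁ ⨯ t₂) (normalised-≢⇒⨯≢0₃ t₁-normalised t₂-normalised t₁≢t₂)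
      in TwoRankOnePoints.order≤rankCount₂ only-t₁-t₂ k₁≢0 k₂≢0 a≢0 k₁·t₁≡aa k₂·t₂≡bb W≢0

lemma4p6 : ∀ {c : Level} (F : FiniteField c) → FiniteField.order F % 2 ≡ 1 →
    ∀ (u₁ u₂ u₃ : PG5.Vec6 F) → PG5.LinearlyIndependent F u₁ u₂ u₃ →
    ¬ (PG5.rankCount F u₁ u₂ u₃ 1 ≡ 2 × PG5.rankCount F u₁ u₂ u₃ 2 < FiniteField.order F)
lemma4p6 F _ u₁ u₂ u₃ independent (count₁≡2 , count₂<q) =
  ℕ.<⇒≱ count₂<q (Plane.rankCount₁≡2⇒order≤rankCount₂ F u₁ u₂ u₃ independent count₁≡2)
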